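{- Let $n \geq 2$ and let $q$ be a prime power. For $x = (x_1,\dots,x_{n-1}) \in (\mathbb{F}_q^*)^{n-1}$ put $F_0(x) = \prod_{i=1}^{n-1} x_i$, $F_i(x) = x_i F_0(x)$ for $i \in \{1,\dots,n-1\}$, and $F(x) = \langle (1, F_0(x), F_1(x), \dots, F_{n-1}(x)) \rangle$, a point of $\mathrm{PG}(n,q)$. Let $X = \{F(x) : x \in (\mathbb{F}_q^*)^{n-1}\}$. Then $|X| = (q-1)^{n-1}$.
   Context: $\mathrm{PG}(n,q)$ is the projective space whose points are the $1$-dimensional subspaces of $\mathbb{F}_q^{n+1}$; $\mathbb{F}_q^* = \mathbb{F}_q \setminus \{0\}$. -}

module Defs where

open import Level using (Level; _⊔_)
open import Data.Nat using (ℕ; zero; suc; _^_; _≤_)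
open import Data.Nat.Primality using (Prime)
open import Data.Fin using (Fin; zero; suc)
open import Data.Product using (Σ; ∃; _×_; _,_; proj₁)
open import Relation.Nullary using (¬_)
open import Relation.Binary.PropositionalEquality as ≡ using (_≡_)
open import Function.Bundles using (Bijection)
open import Algebra.Bundles using (CommutativeRing)

IsPrimePower : ℕ → Set
IsPrimePower q = Σ ℕ λ p → Σ ℕ λ k → Prime p × (1 ≤ k) × (q ≡ p ^ k)

record IsField {c ℓ : Level} (R : CommutativeRing c ℓ) : Set (c ⊔ ℓ) where
  open CommutativeRing R hiding (zero)
  field
    0≉1 : ¬ (0# ≈ 1#)
    inverse : ∀ a → ¬ (a ≈ 0#) → ∃ λ b → a * b ≈ 1#

HasOrder : {c ℓ : Level} → CommutativeRing c ℓ → ℕ → Set (c ⊔ ℓ)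
HasOrder R q = Bijection (CommutativeRing.setoid R) (≡.setoid (Fin q))

HasSize : {a r : Level} (A : Set a) → (A → A → Set r) → ℕ → Set (a ⊔ r)
HasSize A _∼_ k = Σ (Fin k → A) λ e →
  (∀ x → ∃ λ i → x ∼ e i) × (∀ i j → e i ∼ e j → i ≡ j)

module Construction {c ℓ : Level} (R : CommutativeRing c ℓ) where
  open CommutativeRing R hiding (zero)

  Units : Set (c ⊔ ℓ)
  Units = Σ Carrier λ a → ¬ (a ≈ 0#)

  prod : ∀ {k} → (Fin k → Units) → Carrier
  prod {zero} x = 1#
  prod {suc k} x = proj₁ (x zero) * prod (λ i → x (suc i))

  -- points of PG(d, q): nonzero vectors of 𝔽^(d+1), compared by _∼_ below
  Point : ℕ → Set (c ⊔ ℓ)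
  Point d = Σ (Fin (suc d) → Carrier) λ v → ¬ (∀ i → v i ≈ 0#)

  _∼_ : ∀ {d} → Point d → Point d → Set (c ⊔ ℓ)
  _∼_ {d} v w = ∃ λ (μ : Units) → ∀ i → proj₁ v i ≈ proj₁ μ * proj₁ w i

  F₀ : ∀ {k} → (Fin k → Units) → Carrier
  F₀ = prod

  -- coordinate vector (1, F₀(x), F₁(x), …, F_k(x)) with Fᵢ(x) = xᵢ F₀(x)
  Fvec : ∀ {k} → (Fin k → Units) → Fin (suc (suc k)) → Carrier
  Fvec x zero = 1#
  Fvec x (suc zero) = F₀ x
  Fvec x (suc (suc i)) = proj₁ (x i) * F₀ x

  XElem : ℕ → Set (c ⊔ ℓ)
  XElem k = Σ (Point (suc k)) λ P →
    ∃ λ (x : Fin k → Units) → ∀ i → proj₁ P i ≈ Fvec x i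

  _∼X_ : ∀ {k} → XElem k → XElem k → Set (c ⊔ ℓ)
  P ∼X Q = proj₁ P ∼ proj₁ Q

{-# OPTIONS --safe #-}
-- F stays injective on (𝔽*)^k even up to scalars: the leading coordinate 1 forces the
-- scalar to be 1, the next one gives F₀(x) = F₀(y), and the nonzero F₀ cancels from
-- Fᵢ = xᵢ F₀. So X is the injective image of (𝔽*)^k, which has (q - 1)^k elements.
module Submission where

open import Defs
open import Level using (Level)
open import Data.Nat using (ℕ; zero; suc; _∸_; _^_; _≤_)
open import Data.Fin using (Fin; zero; suc; punchIn; punchOut; combine; finToFun; funToFin)
open import Data.Fin.Properties
  using (punchIn-injective; punchInᵢ≢i; punchIn-punchOut; finToFun-funToFin; funToFin-finToFin)
open import Data.Product using (∃; _,_; proj₁; proj₂)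
open import Function using (_∘_)
open import Function.Bundles using (Bijection)
open import Relation.Nullary using (¬_)
open import Relation.Binary.Core using (Rel)
open import Relation.Binary.Definitions using (Transitive)
open import Relation.Binary.PropositionalEquality as ≡ using (_≡_; _≢_; _≗_)
open import Algebra.Bundles using (CommutativeRing)
import Relation.Binary.Reasoning.Setoid as SetoidReasoning

funToFin-cong : ∀ {m k} {f g : Fin k → Fin m} → f ≗ g → funToFin f ≡ funToFin g
funToFin-cong {k = zero}  _   = ≡.refl
funToFin-cong {k = suc k} f≗g = ≡.cong₂ combine (f≗g zero) (funToFin-cong (f≗g ∘ suc))

module _ {a r} {A : Set a} {_≈_ : Rel A r} where

  HasSize-→ : ∀ {m} k → HasSize A _≈_ m →
    HasSize (Fin k → A) (λ f g → ∀ i → f i ≈ g i) (m ^ k)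
  HasSize-→ {m} k (e , surj , inj) = (λ i j → e (finToFun i j)) , surj′ , inj′
    where
    surj′ : ∀ f → ∃ λ i → ∀ j → f j ≈ e (finToFun i j)
    surj′ f = funToFin (proj₁ ∘ surj ∘ f) , λ j →
      ≡.subst (λ t → f j ≈ e t) (≡.sym (finToFun-funToFin (proj₁ ∘ surj ∘ f) j)) (proj₂ (surj (f j)))

    inj′ : ∀ i i′ → (∀ j → e (finToFun i j) ≈ e (finToFun i′ j)) → i ≡ i′
    inj′ i i′ h = begin
      i                               ≡⟨ ≡.sym (funToFin-finToFin {k} {m} i) ⟩
      funToFin (finToFun {m} {k} i)   ≡⟨ funToFin-cong (λ j → inj _ _ (h j)) ⟩
      funToFin (finToFun {m} {k} i′)  ≡⟨ funToFin-finToFin {k} {m} i′ ⟩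
      i′                              ∎
      where open ≡.≡-Reasoning

  HasSize-image : ∀ {b s k} {B : Set b} {_∼_ : Rel B s} (f : A → B) → Transitive _∼_ →
    (∀ {x y} → x ≈ y → f x ∼ f y) → (∀ {x y} → f x ∼ f y → x ≈ y) →
    (∀ y → ∃ λ x → y ∼ f x) → HasSize A _≈_ k → HasSize B _∼_ k
  HasSize-image {_∼_ = _∼_} f trans f-cong f-reflects f-covers (e , surj , inj) =
    f ∘ e , surj′ , λ i j → inj i j ∘ f-reflects
    where
    surj′ : ∀ y → ∃ λ i → y ∼ f (e i)
    surj′ y with f-covers y
    ... | x , y∼fx with surj x
    ...   | i , x≈ei = i , trans y∼fx (f-cong x≈ei)

module Nonzero {c ℓ} (R : CommutativeRing c ℓ) where
  open CommutativeRing R hiding (zero)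
  open Construction R

  _≈ᵘ_ : Rel Units ℓ
  u ≈ᵘ v = proj₁ u ≈ proj₁ v

  _≋ᵘ_ : ∀ {k} → Rel (Fin k → Units) ℓ
  x ≋ᵘ y = ∀ i → x i ≈ᵘ y i

  Units-hasSize : ∀ {m} → HasOrder R (suc m) → HasSize Units _≈ᵘ_ m
  Units-hasSize {m} order = e , surj , inj
    where
    open Bijection order

    to∘to⁻ : ∀ i → to (to⁻ i) ≡ i
    to∘to⁻ = proj₂ ∘ strictlySurjective

    to0 : Fin (suc m)
    to0 = to 0#

    e : Fin m → Units
    e i = to⁻ (punchIn to0 i) , λ e≈0 →
      punchInᵢ≢i to0 i (≡.trans (≡.sym (to∘to⁻ _)) (cong e≈0))

    nonzero⇒to0≢to : ∀ {a} → ¬ (a ≈ 0#) → to0 ≢ to a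
    nonzero⇒to0≢to a≉0 = a≉0 ∘ injective ∘ ≡.sym

    surj : ∀ u → ∃ λ i → u ≈ᵘ e i
    surj (a , a≉0) = punchOut (nonzero⇒to0≢to a≉0) , injective (≡.sym (begin
      to (to⁻ (punchIn to0 (punchOut (nonzero⇒to0≢to a≉0))))
        ≡⟨ to∘to⁻ _ ⟩
      punchIn to0 (punchOut (nonzero⇒to0≢to a≉0))
        ≡⟨ punchIn-punchOut (nonzero⇒to0≢to a≉0) ⟩
      to a ∎))
      where open ≡.≡-Reasoning

    inj : ∀ i j → e i ≈ᵘ e j → i ≡ j
    inj i j ei≈ej = punchIn-injective to0 i j
      (≡.trans (≡.sym (to∘to⁻ _)) (≡.trans (cong ei≈ej) (to∘to⁻ _)))

module _ {c ℓ} (R : CommutativeRing c ℓ) (isField : IsField R) where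
  open CommutativeRing R hiding (zero)
  open IsField isField
  open Construction R
  open Nonzero R
  open SetoidReasoning setoid

  *-cancelʳ-nonzero : ∀ {a b d} → ¬ (d ≈ 0#) → a * d ≈ b * d → a ≈ b
  *-cancelʳ-nonzero {a} {b} {d} d≉0 ad≈bd with inverse d d≉0
  ... | d⁻¹ , dd⁻¹≈1 = begin
    a              ≈⟨ sym (*-identityʳ a) ⟩
    a * 1#         ≈⟨ *-congˡ (sym dd⁻¹≈1) ⟩
    a * (d * d⁻¹)  ≈⟨ sym (*-assoc a d d⁻¹) ⟩
    a * d * d⁻¹    ≈⟨ *-congʳ ad≈bd ⟩
    b * d * d⁻¹    ≈⟨ *-assoc b d d⁻¹ ⟩
    b * (d * d⁻¹)  ≈⟨ *-congˡ dd⁻¹≈1 ⟩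
    b * 1#         ≈⟨ *-identityʳ b ⟩
    b              ∎

  *-nonzero : ∀ {a b} → ¬ (a ≈ 0#) → ¬ (b ≈ 0#) → ¬ (a * b ≈ 0#)
  *-nonzero {a} {b} a≉0 b≉0 ab≈0 =
    b≉0 (*-cancelʳ-nonzero a≉0 (trans (*-comm b a) (trans ab≈0 (sym (zeroˡ a)))))

  prod-nonzero : ∀ {k} (x : Fin k → Units) → ¬ (prod x ≈ 0#)
  prod-nonzero {zero}  _ 1≈0 = 0≉1 (sym 1≈0)
  prod-nonzero {suc k} x     = *-nonzero (proj₂ (x zero)) (prod-nonzero (x ∘ suc))

  prod-cong : ∀ {k} {x y : Fin k → Units} → x ≋ᵘ y → prod x ≈ prod y
  prod-cong {zero}  _   = refl
  prod-cong {suc k} x≈y = *-cong (x≈y zero) (prod-cong (x≈y ∘ suc))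

  Fvec-cong : ∀ {k} {x y : Fin k → Units} → x ≋ᵘ y → ∀ i → Fvec x i ≈ Fvec y i
  Fvec-cong _   zero          = refl
  Fvec-cong x≈y (suc zero)    = prod-cong x≈y
  Fvec-cong x≈y (suc (suc i)) = *-cong (x≈y i) (prod-cong x≈y)

  ∼-trans : ∀ {d} {u v w : Point d} → u ∼ v → v ∼ w → u ∼ w
  ∼-trans ((μ , μ≉0) , v≈μw) ((ν , ν≉0) , w≈νu) =
    (μ * ν , *-nonzero μ≉0 ν≉0) , λ i →
      trans (v≈μw i) (trans (*-congˡ (w≈νu i)) (sym (*-assoc μ ν _)))

  1ᵘ : Units
  1ᵘ = 1# , 0≉1 ∘ sym

  F : ∀ {k} → (Fin k → Units) → XElem k
  F x = (Fvec x , λ Fvec≈0 → 0≉1 (sym (Fvec≈0 zero))) , x , λ _ → refl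

  F-covers : ∀ {k} (P : XElem k) → ∃ λ x → P ∼X F x
  F-covers (_ , x , P≈Fvec) = x , 1ᵘ , λ i → trans (P≈Fvec i) (sym (*-identityˡ _))

  F-cong : ∀ {k} {x y : Fin k → Units} → x ≋ᵘ y → F x ∼X F y
  F-cong x≈y = 1ᵘ , λ i → trans (Fvec-cong x≈y i) (sym (*-identityˡ _))

  F-injective : ∀ {k} {x y : Fin k → Units} → F x ∼X F y → x ≋ᵘ y
  F-injective {x = x} {y} ((μ , _) , Fx≈μFy) i = *-cancelʳ-nonzero (prod-nonzero x) (begin
    proj₁ (x i) * prod x         ≈⟨ Fx≈μFy (suc (suc i)) ⟩
    μ * (proj₁ (y i) * prod y)   ≈⟨ *-congʳ μ≈1 ⟩
    1# * (proj₁ (y i) * prod y)  ≈⟨ *-identityˡ _ ⟩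
    proj₁ (y i) * prod y         ≈⟨ *-congˡ (sym F₀x≈F₀y) ⟩
    proj₁ (y i) * prod x         ∎)
    where
    μ≈1 : μ ≈ 1#
    μ≈1 = sym (trans (Fx≈μFy zero) (*-identityʳ μ))

    F₀x≈F₀y : prod x ≈ prod y
    F₀x≈F₀y = trans (Fx≈μFy (suc zero)) (trans (*-congʳ μ≈1) (*-identityˡ _))

  X-hasSize : ∀ {m} → HasOrder R (suc m) → ∀ k → HasSize (XElem k) _∼X_ (m ^ k)
  X-hasSize order k =
    -- _∼_ only inspects coordinates, so Agda cannot infer the points it relates.
    HasSize-image {_∼_ = _∼X_ {k}} F
      (λ {P} {Q} {S} → ∼-trans {u = proj₁ P} {proj₁ Q} {proj₁ S})
      (λ {x} {y} → F-cong {x = x} {y}) (λ {x} {y} → F-injective {x = x} {y}) F-covers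
      (HasSize-→ {_≈_ = _≈ᵘ_} k (Units-hasSize order))

lemma3 : {c ℓ : Level} (n q : ℕ) → 2 ≤ n → IsPrimePower q →
    (R : CommutativeRing c ℓ) → IsField R → HasOrder R q →
    HasSize (Construction.XElem R (n ∸ 1)) (Construction._∼X_ R) ((q ∸ 1) ^ (n ∸ 1))
lemma3 (suc n) zero    _ _ R _       order with Bijection.to order (CommutativeRing.0# R)
... | ()
lemma3 (suc n) (suc m) _ _ R isField order = X-hasSize R isField order n
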